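{- Let $G$ be a graph whose vertex set is partitioned as $V(G)=A\cup B\cup C$ such that $(G[A\cup B],A,B)$ is a generalized split triad, every vertex of $A$ is adjacent to every vertex of $C$, and no vertex of $B$ is adjacent to any vertex of $C$. Let $D$ be the vertex set of a $P_4$-connected component of $G$. Then $D\subseteq A\cup B$ or $D\subseteq C$.
   Context: Graphs are finite and simple. A triad $(S,A,B)$ is a graph $S$ with an ordered partition $(A,B)$ of $V(S)$. A set $M$ is a module of $S$ if every vertex outside $M$ is adjacent to all or to none of $M$. A triad $(S,A,B)$ is a generalized split triad if every connected component of the complement $\overline{S[A]}$ and every connected component of $S[B]$ is a module of $S$. A graph is $P_4$-connected if for every partition of its vertex set into two nonempty disjoint sets there is an induced $P_4$ containing vertices of both parts. A $P_4$-connected component of $G$ is a maximal induced $P_4$-connected subgraph of $G$. -}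

module Defs where

open import Data.Nat using (ℕ)
open import Data.Fin using (Fin)
open import Data.Bool using (Bool; true; false)
open import Data.Fin.Subset using (Subset; _∈_; _∉_; _⊆_) public
open import Data.Product using (Σ; _×_; _,_; ∃; ∃-syntax)
open import Data.Sum using (_⊎_)
open import Relation.Nullary using (¬_)
open import Relation.Binary.PropositionalEquality using (_≡_; _≢_)

record Graph (n : ℕ) : Set where
  field
    adj     : Fin n → Fin n → Bool
    adj-sym : ∀ u v → adj u v ≡ adj v u
    irrefl  : ∀ v → adj v v ≡ false
open Graph public

module _ {n : ℕ} (G : Graph n) where

  Edge : Fin n → Fin n → Set
  Edge u v = adj G u v ≡ true

  NonEdge : Fin n → Fin n → Set
  NonEdge u v = (u ≢ v) × ¬ Edge u v

  -- M is a module of the induced subgraph G[X] (M ⊆ X assumed by callers)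
  IsModuleIn : Subset n → Subset n → Set
  IsModuleIn X M = ∀ v → v ∈ X → v ∉ M →
    (∀ m → m ∈ M → Edge v m) ⊎ (∀ m → m ∈ M → ¬ Edge v m)

data Path {n : ℕ} (R : Fin n → Fin n → Set) (K : Subset n) : Fin n → Fin n → Set where
  here : ∀ {u} → u ∈ K → Path R K u u
  step : ∀ {u v w} → u ∈ K → R u v → Path R K v w → Path R K u w

IsComponent : {n : ℕ} → (Fin n → Fin n → Set) → Subset n → Subset n → Set
IsComponent {n} R X K =
  (∃[ v ] v ∈ K) ×
  (K ⊆ X) ×
  (∀ u v → u ∈ K → v ∈ K → Path R K u v) ×
  (∀ u v → u ∈ K → v ∈ X → R u v → v ∈ K)

module _ {n : ℕ} (G : Graph n) where

  IsUnion : Subset n → Subset n → Subset n → Set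
  IsUnion X A B = ∀ v → (v ∈ X → v ∈ A ⊎ v ∈ B) × (v ∈ A ⊎ v ∈ B → v ∈ X)

  GeneralizedSplitTriad : Subset n → Subset n → Subset n → Set
  GeneralizedSplitTriad X A B =
    IsUnion X A B ×
    (∀ v → v ∈ A → v ∉ B) ×
    (∀ K → IsComponent (NonEdge G) A K → IsModuleIn G X K) ×
    (∀ K → IsComponent (Edge G) B K → IsModuleIn G X K)

  InducedP4 : Fin n → Fin n → Fin n → Fin n → Set
  InducedP4 a b c d =
    Edge G a b × Edge G b c × Edge G c d ×
    ¬ Edge G a c × ¬ Edge G b d × ¬ Edge G a d ×
    a ≢ b × a ≢ c × a ≢ d × b ≢ c × b ≢ d × c ≢ d

  MeetsP4 : Subset n → Fin n → Fin n → Fin n → Fin n → Set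
  MeetsP4 S a b c d = a ∈ S ⊎ b ∈ S ⊎ c ∈ S ⊎ d ∈ S

  P4Connected : Subset n → Set
  P4Connected D = ∀ D₁ D₂ →
    (∀ v → (v ∈ D → v ∈ D₁ ⊎ v ∈ D₂) × (v ∈ D₁ ⊎ v ∈ D₂ → v ∈ D)) →
    (∀ v → v ∈ D₁ → v ∉ D₂) →
    (∃[ v ] v ∈ D₁) → (∃[ v ] v ∈ D₂) →
    ∃[ a ] ∃[ b ] ∃[ c ] ∃[ d ]
      (a ∈ D × b ∈ D × c ∈ D × d ∈ D × InducedP4 a b c d ×
       MeetsP4 D₁ a b c d × MeetsP4 D₂ a b c d)

  P4Component : Subset n → Set
  P4Component D = P4Connected D × (∀ D' → D ⊆ D' → P4Connected D' → D' ⊆ D)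

module Submission where

-- Every vertex of C sees exactly A inside A ∪ B.  Consider an induced
-- P4  a - b - c - d  with vertices both in A ∪ B and in C.  Up to reversing the
-- path, a or b lies in C; classifying the remaining vertices by their adjacency
-- to that C-vertex leaves only configurations that either contradict the
-- adjacency pattern between A, B and C, or contradict the fact that the
-- components of G[B] and of the complement of G[A] are modules: adjacent
-- vertices of B have the same neighbours in A, and non-adjacent distinct
-- vertices of A have the same neighbours in B.  So no induced P4 meets both
-- A ∪ B and C, and a P4-connected set D covered by these two disjoint sets must
-- lie inside one of them (otherwise the partition of D by them is crossed by an
-- induced P4).

open import Defs
open import Data.Nat using (ℕ)
open import Data.Fin using (Fin; _≟_)
open import Data.Fin.Subset using (Subset; _∈_; _∉_; _⊆_; _∪_; _∩_; ⁅_⁆; _⊃_)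
open import Data.Fin.Subset.Properties
  using (_∈?_; x∈⁅x⁆; x∈⁅y⁆⇒x≡y; p⊆p∪q; q⊆p∪q; x∈p∪q⁻; x∈p∩q⁺; x∈p∩q⁻)
open import Data.Fin.Subset.Induction using (⊃-wellFounded)
open import Data.Fin.Properties using (any?)
open import Data.Bool using (true)
import Data.Bool as Bool
open import Data.Empty using (⊥; ⊥-elim)
open import Data.Product using (_×_; _,_; ∃-syntax; proj₁; proj₂)
open import Data.Sum using (_⊎_; inj₁; inj₂)
open import Induction.WellFounded using (Acc; acc)
open import Relation.Nullary using (¬_; Dec; yes; no; ¬?)
open import Relation.Nullary.Decidable using (_×-dec_; decidable-stable)
open import Relation.Binary.PropositionalEquality using (sym; trans; subst; ≢-sym)

module _ {n : ℕ} (R : Fin n → Fin n → Set) where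

  path-snoc : ∀ {K u v w} → Path R K u v → R v w → w ∈ K → Path R K u w
  path-snoc (here v∈K)        r w∈K = step v∈K r (here w∈K)
  path-snoc (step u∈K r′ p)   r w∈K = step u∈K r′ (path-snoc p r w∈K)

  path-append : ∀ {K u v w} → Path R K u v → Path R K v w → Path R K u w
  path-append (here _)         q = q
  path-append (step u∈K r p)   q = step u∈K r (path-append p q)

  path-mono : ∀ {K K′ u v} → K ⊆ K′ → Path R K u v → Path R K′ u v
  path-mono K⊆K′ (here u∈K)       = here (K⊆K′ u∈K)
  path-mono K⊆K′ (step u∈K r p)   = step (K⊆K′ u∈K) r (path-mono K⊆K′ p)

  path-reverse : (∀ u v → R u v → R v u) → ∀ {K u v} → Path R K u v → Path R K v u
  path-reverse R-sym (here u∈K)       = here u∈K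
  path-reverse R-sym (step u∈K r p)   = path-snoc (path-reverse R-sym p) (R-sym _ _ r) u∈K

-- The component is grown from ⁅ u ⁆ by adding any
-- R-neighbour in X outside the current set; this terminates since subsets of
-- Fin n are well-founded under strict inclusion.
module ComponentOf {n : ℕ} (R : Fin n → Fin n → Set) (R? : ∀ u v → Dec (R u v))
    (R-sym : ∀ u v → R u v → R v u) (X : Subset n) (u : Fin n) (u∈X : u ∈ X) where

  Grown : Subset n → Set
  Grown S = u ∈ S × S ⊆ X × (∀ v → v ∈ S → Path R S u v)

  Exit : Subset n → Set
  Exit S = ∃[ w ] ∃[ v ] (w ∈ S × v ∈ X × R w v × v ∉ S)

  exit? : ∀ S → Dec (Exit S)
  exit? S = any? λ w → any? λ v →
    (w ∈? S) ×-dec (v ∈? X) ×-dec R? w v ×-dec ¬? (v ∈? S)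

  grow : ∀ {S w v} → Grown S → w ∈ S → v ∈ X → R w v → Grown (S ∪ ⁅ v ⁆)
  grow {S} {w} {v} (u∈S , S⊆X , reach) w∈S v∈X r = p⊆p∪q _ u∈S , S′⊆X , reach′
    where
    v∈S′ : v ∈ S ∪ ⁅ v ⁆
    v∈S′ = q⊆p∪q S ⁅ v ⁆ (x∈⁅x⁆ v)
    S′⊆X : S ∪ ⁅ v ⁆ ⊆ X
    S′⊆X x∈ with x∈p∪q⁻ S ⁅ v ⁆ x∈
    ... | inj₁ x∈S  = S⊆X x∈S
    ... | inj₂ x∈v  = subst (_∈ X) (sym (x∈⁅y⁆⇒x≡y v x∈v)) v∈X
    reach′ : ∀ x → x ∈ S ∪ ⁅ v ⁆ → Path R (S ∪ ⁅ v ⁆) u x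
    reach′ x x∈ with x∈p∪q⁻ S ⁅ v ⁆ x∈
    ... | inj₁ x∈S = path-mono R (p⊆p∪q _) (reach x x∈S)
    ... | inj₂ x∈v rewrite x∈⁅y⁆⇒x≡y v x∈v =
      path-snoc R (path-mono R (p⊆p∪q _) (reach w w∈S)) r v∈S′

  closed⇒component : ∀ {S} → Grown S → ¬ Exit S → IsComponent R X S
  closed⇒component {S} (u∈S , S⊆X , reach) no-exit =
    (u , u∈S) , S⊆X , connected , maximal
    where
    connected : ∀ x y → x ∈ S → y ∈ S → Path R S x y
    connected x y x∈S y∈S =
      path-append R (path-reverse R R-sym (reach x x∈S)) (reach y y∈S)
    maximal : ∀ x y → x ∈ S → y ∈ X → R x y → y ∈ S
    maximal x y x∈S y∈X r =
      decidable-stable (y ∈? S) (λ y∉S → no-exit (x , y , x∈S , y∈X , r , y∉S))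

  grow-until-closed : ∀ S → Acc _⊃_ S → Grown S → ∃[ K ] (IsComponent R X K × u ∈ K)
  grow-until-closed S (acc smaller) grown with exit? S
  ... | no no-exit = S , closed⇒component grown no-exit , proj₁ grown
  ... | yes (w , v , w∈S , v∈X , r , v∉S) =
    grow-until-closed (S ∪ ⁅ v ⁆)
      (smaller (p⊆p∪q _ , v , q⊆p∪q S ⁅ v ⁆ (x∈⁅x⁆ v) , v∉S))
      (grow grown w∈S v∈X r)

  component : ∃[ K ] (IsComponent R X K × u ∈ K)
  component = grow-until-closed ⁅ u ⁆ (⊃-wellFounded _) (x∈⁅x⁆ u , u⊆X , reach)
    where
    u⊆X : ⁅ u ⁆ ⊆ X
    u⊆X x∈ = subst (_∈ X) (sym (x∈⁅y⁆⇒x≡y u x∈)) u∈X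
    reach : ∀ v → v ∈ ⁅ u ⁆ → Path R ⁅ u ⁆ u v
    reach v v∈ rewrite x∈⁅y⁆⇒x≡y u v∈ = here (x∈⁅x⁆ u)

module _ {n : ℕ} (G : Graph n) where

  edge-sym : ∀ {u v} → Edge G u v → Edge G v u
  edge-sym {u} {v} e = trans (adj-sym G v u) e

  non-edge-sym : ∀ {u v} → ¬ Edge G u v → ¬ Edge G v u
  non-edge-sym ¬e e = ¬e (edge-sym e)

  edge? : ∀ u v → Dec (Edge G u v)
  edge? u v = adj G u v Bool.≟ true

  -- If every component of (X, R) is a module of G[Y], then two R-related
  -- vertices of X have the same neighbours in Y outside X: they lie in one
  -- component, which the outside vertex sees completely or not at all.
  component-twins : (R : Fin n → Fin n → Set) → (∀ u v → Dec (R u v)) →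
    (∀ u v → R u v → R v u) → (X Y : Subset n) →
    (∀ K → IsComponent R X K → IsModuleIn G Y K) →
    ∀ {v y z} → y ∈ X → z ∈ X → R y z → v ∈ Y → v ∉ X →
    Edge G v y → Edge G v z
  component-twins R R? R-sym X Y modules {v} {y} {z} y∈X z∈X r v∈Y v∉X evy
    with ComponentOf.component R R? R-sym X y y∈X
  ... | K , K-comp@(_ , K⊆X , _ , maximal) , y∈K
    with modules K K-comp v v∈Y (λ v∈K → v∉X (K⊆X v∈K))
  ... | inj₁ sees-all  = sees-all z (maximal y z y∈K z∈X r)
  ... | inj₂ sees-none = ⊥-elim (sees-none y y∈K evy)

  reverse-P4 : ∀ {a b c d} → InducedP4 G a b c d → InducedP4 G d c b a
  reverse-P4 (eab , ebc , ecd , nac , nbd , nad , a≢b , a≢c , a≢d , b≢c , b≢d , c≢d) =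
    edge-sym ecd , edge-sym ebc , edge-sym eab ,
    non-edge-sym nbd , non-edge-sym nac , non-edge-sym nad ,
    ≢-sym c≢d , ≢-sym b≢d , ≢-sym a≢d , ≢-sym b≢c , ≢-sym a≢c , ≢-sym a≢b

  reverse-meets : ∀ {S a b c d} → MeetsP4 G S a b c d → MeetsP4 G S d c b a
  reverse-meets (inj₁ a∈)                 = inj₂ (inj₂ (inj₂ a∈))
  reverse-meets (inj₂ (inj₁ b∈))          = inj₂ (inj₂ (inj₁ b∈))
  reverse-meets (inj₂ (inj₂ (inj₁ c∈)))   = inj₂ (inj₁ c∈)
  reverse-meets (inj₂ (inj₂ (inj₂ d∈)))   = inj₁ d∈

  meets-mono : ∀ {S T a b c d} → S ⊆ T → MeetsP4 G S a b c d → MeetsP4 G T a b c d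
  meets-mono S⊆T (inj₁ a∈)                 = inj₁ (S⊆T a∈)
  meets-mono S⊆T (inj₂ (inj₁ b∈))          = inj₂ (inj₁ (S⊆T b∈))
  meets-mono S⊆T (inj₂ (inj₂ (inj₁ c∈)))   = inj₂ (inj₂ (inj₁ (S⊆T c∈)))
  meets-mono S⊆T (inj₂ (inj₂ (inj₂ d∈)))   = inj₂ (inj₂ (inj₂ (S⊆T d∈)))

  ⊆-or-escapes : (D X : Subset n) → D ⊆ X ⊎ ∃[ v ] (v ∈ D × v ∉ X)
  ⊆-or-escapes D X with any? (λ v → (v ∈? D) ×-dec ¬? (v ∈? X))
  ... | yes escape = inj₂ escape
  ... | no  none   =
    inj₁ λ {v} v∈D → decidable-stable (v ∈? X) (λ v∉X → none (v , v∈D , v∉X))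

  -- A P4-connected set covered by two disjoint sets X and Y, no induced P4 of
  -- which meets both, lies inside X or inside Y: otherwise D ∩ X, D ∩ Y is a
  -- partition of D into nonempty parts crossed by an induced P4.
  P4Connected-within : ∀ {D X Y} → P4Connected G D →
    (∀ v → v ∈ D → v ∈ X ⊎ v ∈ Y) → (∀ v → v ∈ X → v ∉ Y) →
    (∀ {a b c d} → InducedP4 G a b c d →
       MeetsP4 G X a b c d → MeetsP4 G Y a b c d → ⊥) →
    D ⊆ X ⊎ D ⊆ Y
  P4Connected-within {D} {X} {Y} connected cover disjoint no-crossing-P4
    with ⊆-or-escapes D X | ⊆-or-escapes D Y
  ... | inj₁ D⊆X | _        = inj₁ D⊆X
  ... | _        | inj₁ D⊆Y = inj₂ D⊆Y
  ... | inj₂ (y , y∈D , y∉X) | inj₂ (x , x∈D , x∉Y)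
    with connected (D ∩ X) (D ∩ Y) partition parts-disjoint
           (x , in-part x∈D (in-X x∈D x∉Y)) (y , in-part y∈D (in-Y y∈D y∉X))
    where
    in-part : ∀ {v S} → v ∈ D → v ∈ S → v ∈ D ∩ S
    in-part v∈D v∈S = x∈p∩q⁺ (v∈D , v∈S)
    in-X : ∀ {v} → v ∈ D → v ∉ Y → v ∈ X
    in-X {v} v∈D v∉Y with cover v v∈D
    ... | inj₁ v∈X = v∈X
    ... | inj₂ v∈Y = ⊥-elim (v∉Y v∈Y)
    in-Y : ∀ {v} → v ∈ D → v ∉ X → v ∈ Y
    in-Y {v} v∈D v∉X with cover v v∈D
    ... | inj₁ v∈X = ⊥-elim (v∉X v∈X)
    ... | inj₂ v∈Y = v∈Y
    partition : ∀ v → (v ∈ D → v ∈ D ∩ X ⊎ v ∈ D ∩ Y) × (v ∈ D ∩ X ⊎ v ∈ D ∩ Y → v ∈ D)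
    partition v = split , merge
      where
      split : v ∈ D → v ∈ D ∩ X ⊎ v ∈ D ∩ Y
      split v∈D with cover v v∈D
      ... | inj₁ v∈X = inj₁ (in-part v∈D v∈X)
      ... | inj₂ v∈Y = inj₂ (in-part v∈D v∈Y)
      merge : v ∈ D ∩ X ⊎ v ∈ D ∩ Y → v ∈ D
      merge (inj₁ v∈) = proj₁ (x∈p∩q⁻ D X v∈)
      merge (inj₂ v∈) = proj₁ (x∈p∩q⁻ D Y v∈)
    parts-disjoint : ∀ v → v ∈ D ∩ X → v ∉ D ∩ Y
    parts-disjoint v v∈DX v∈DY =
      disjoint v (proj₂ (x∈p∩q⁻ D X v∈DX)) (proj₂ (x∈p∩q⁻ D Y v∈DY))
  ... | (_ , _ , _ , _ , _ , _ , _ , _ , P , meets-X , meets-Y) =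
    ⊥-elim (no-crossing-P4 P (meets-mono (λ v∈ → proj₂ (x∈p∩q⁻ D X v∈)) meets-X)
                             (meets-mono (λ v∈ → proj₂ (x∈p∩q⁻ D Y v∈)) meets-Y))

module SplitTriadWithC {n : ℕ} (G : Graph n) (A B C AB : Subset n)
    (cover : ∀ v → v ∈ A ⊎ v ∈ B ⊎ v ∈ C)
    (A∩B=∅ : ∀ v → v ∈ A → v ∉ B) (A∩C=∅ : ∀ v → v ∈ A → v ∉ C)
    (B∩C=∅ : ∀ v → v ∈ B → v ∉ C)
    (triad : GeneralizedSplitTriad G AB A B)
    (A-complete-C : ∀ a c → a ∈ A → c ∈ C → Edge G a c)
    (B-anticomplete-C : ∀ b c → b ∈ B → c ∈ C → ¬ Edge G b c) where

  AB⇒A⊎B : ∀ {v} → v ∈ AB → v ∈ A ⊎ v ∈ B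
  AB⇒A⊎B {v} = proj₁ (proj₁ triad v)

  A⊎B⇒AB : ∀ {v} → v ∈ A ⊎ v ∈ B → v ∈ AB
  A⊎B⇒AB {v} = proj₂ (proj₁ triad v)

  AB∩C=∅ : ∀ v → v ∈ AB → v ∉ C
  AB∩C=∅ v v∈AB with AB⇒A⊎B v∈AB
  ... | inj₁ v∈A = A∩C=∅ v v∈A
  ... | inj₂ v∈B = B∩C=∅ v v∈B

  B-edge-twins : ∀ {x y z} → x ∈ A → y ∈ B → z ∈ B →
    Edge G y z → Edge G x y → Edge G x z
  B-edge-twins x∈A y∈B z∈B eyz =
    component-twins G (Edge G) (edge? G) (λ _ _ → edge-sym G) B AB
      (proj₂ (proj₂ (proj₂ triad))) y∈B z∈B eyz
      (A⊎B⇒AB (inj₁ x∈A)) (A∩B=∅ _ x∈A)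

  A-non-edge-twins : ∀ {x y z} → x ∈ B → y ∈ A → z ∈ A →
    NonEdge G y z → Edge G x y → Edge G x z
  A-non-edge-twins x∈B y∈A z∈A nyz =
    component-twins G (NonEdge G) non-edge? non-edge-relation-sym A AB
      (proj₁ (proj₂ (proj₂ triad))) y∈A z∈A nyz
      (A⊎B⇒AB (inj₂ x∈B)) (λ x∈A → A∩B=∅ _ x∈A x∈B)
    where
    non-edge? : ∀ u v → Dec (NonEdge G u v)
    non-edge? u v = ¬? (u ≟ v) ×-dec ¬? (edge? G u v)
    non-edge-relation-sym : ∀ u v → NonEdge G u v → NonEdge G v u
    non-edge-relation-sym u v (u≢v , ¬e) = ≢-sym u≢v , non-edge-sym G ¬e

  neighbour-of-C : ∀ {x y} → x ∈ C → Edge G x y → y ∈ A ⊎ y ∈ C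
  neighbour-of-C {x} {y} x∈C exy with cover y
  ... | inj₁ y∈A          = inj₁ y∈A
  ... | inj₂ (inj₁ y∈B)   = ⊥-elim (B-anticomplete-C y x y∈B x∈C (edge-sym G exy))
  ... | inj₂ (inj₂ y∈C)   = inj₂ y∈C

  non-neighbour-of-C : ∀ {x y} → x ∈ C → ¬ Edge G x y → y ∈ B ⊎ y ∈ C
  non-neighbour-of-C {x} {y} x∈C ¬exy with cover y
  ... | inj₁ y∈A          = ⊥-elim (¬exy (edge-sym G (A-complete-C y x y∈A x∈C)))
  ... | inj₂ (inj₁ y∈B)   = inj₁ y∈B
  ... | inj₂ (inj₂ y∈C)   = inj₂ y∈C

  not-all-in-C : ∀ {a b c d} → MeetsP4 G AB a b c d →
    a ∈ C → b ∈ C → c ∈ C → d ∈ C → ⊥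
  not-all-in-C (inj₁ a∈AB)               a∈C _ _ _ = AB∩C=∅ _ a∈AB a∈C
  not-all-in-C (inj₂ (inj₁ b∈AB))        _ b∈C _ _ = AB∩C=∅ _ b∈AB b∈C
  not-all-in-C (inj₂ (inj₂ (inj₁ c∈AB))) _ _ c∈C _ = AB∩C=∅ _ c∈AB c∈C
  not-all-in-C (inj₂ (inj₂ (inj₂ d∈AB))) _ _ _ d∈C = AB∩C=∅ _ d∈AB d∈C

  P4-end-not-in-C : ∀ {a b c d} → InducedP4 G a b c d → MeetsP4 G AB a b c d →
    a ∈ C → ⊥
  P4-end-not-in-C (eab , ebc , ecd , nac , nbd , nad , _) meets a∈C
    with neighbour-of-C a∈C eab | non-neighbour-of-C a∈C nac
       | non-neighbour-of-C a∈C nad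
  ... | inj₂ b∈C | inj₂ c∈C | inj₂ d∈C = not-all-in-C meets a∈C b∈C c∈C d∈C
  ... | inj₂ b∈C | inj₁ c∈B | _        = B-anticomplete-C _ _ c∈B b∈C (edge-sym G ebc)
  ... | _        | inj₂ c∈C | inj₁ d∈B = B-anticomplete-C _ _ d∈B c∈C (edge-sym G ecd)
  ... | _        | inj₁ c∈B | inj₂ d∈C = B-anticomplete-C _ _ c∈B d∈C ecd
  ... | inj₁ b∈A | inj₂ c∈C | inj₂ d∈C = nbd (A-complete-C _ _ b∈A d∈C)
  ... | inj₁ b∈A | inj₁ c∈B | inj₁ d∈B = nbd (B-edge-twins b∈A c∈B d∈B ecd ebc)

  P4-inner-not-in-C : ∀ {a b c d} → InducedP4 G a b c d → MeetsP4 G AB a b c d →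
    b ∈ C → ⊥
  P4-inner-not-in-C P@(eab , ebc , ecd , nac , nbd , nad , _ , a≢c , _) meets b∈C
    with neighbour-of-C b∈C (edge-sym G eab) | neighbour-of-C b∈C ebc
       | non-neighbour-of-C b∈C nbd
  ... | inj₂ a∈C | _        | _        = P4-end-not-in-C P meets a∈C
  ... | inj₁ a∈A | _        | inj₂ d∈C = nad (A-complete-C _ _ a∈A d∈C)
  ... | inj₁ _   | inj₂ c∈C | inj₁ d∈B = B-anticomplete-C _ _ d∈B c∈C (edge-sym G ecd)
  ... | inj₁ a∈A | inj₁ c∈A | inj₁ d∈B =
    nad (edge-sym G (A-non-edge-twins d∈B c∈A a∈A (≢-sym a≢c , non-edge-sym G nac)
                                      (edge-sym G ecd)))

  no-P4-across : ∀ {a b c d} → InducedP4 G a b c d →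
    MeetsP4 G AB a b c d → MeetsP4 G C a b c d → ⊥
  no-P4-across P meets (inj₁ a∈C)               = P4-end-not-in-C P meets a∈C
  no-P4-across P meets (inj₂ (inj₁ b∈C))        = P4-inner-not-in-C P meets b∈C
  no-P4-across P meets (inj₂ (inj₂ (inj₁ c∈C))) =
    P4-inner-not-in-C (reverse-P4 G P) (reverse-meets G meets) c∈C
  no-P4-across P meets (inj₂ (inj₂ (inj₂ d∈C))) =
    P4-end-not-in-C (reverse-P4 G P) (reverse-meets G meets) d∈C

  AB-or-C : ∀ v → v ∈ AB ⊎ v ∈ C
  AB-or-C v with cover v
  ... | inj₁ v∈A          = inj₁ (A⊎B⇒AB (inj₁ v∈A))
  ... | inj₂ (inj₁ v∈B)   = inj₁ (A⊎B⇒AB (inj₂ v∈B))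
  ... | inj₂ (inj₂ v∈C)   = inj₂ v∈C

mainTheorem7 : ∀ {n : ℕ} (G : Graph n) (A B C AB D : Subset n) →
    (∀ v → v ∈ A ⊎ v ∈ B ⊎ v ∈ C) →
    (∀ v → v ∈ A → v ∉ B) → (∀ v → v ∈ A → v ∉ C) → (∀ v → v ∈ B → v ∉ C) →
    GeneralizedSplitTriad G AB A B →
    (∀ a c → a ∈ A → c ∈ C → Edge G a c) →
    (∀ b c → b ∈ B → c ∈ C → ¬ Edge G b c) →
    P4Component G D →
    D ⊆ AB ⊎ D ⊆ C
mainTheorem7 G A B C AB D cover A∩B=∅ A∩C=∅ B∩C=∅ triad A-complete-C B-anticomplete-C
  (P4-connected , _) =
  P4Connected-within G P4-connected (λ v _ → AB-or-C v) AB∩C=∅ no-P4-across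
  where
  open SplitTriadWithC G A B C AB cover A∩B=∅ A∩C=∅ B∩C=∅ triad
         A-complete-C B-anticomplete-C
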